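{- Let $0<p<1$ be a probability and $n,m$ positive integers. Let $X_1,\dots,X_m$ be independent random subsets of $[n]$, each distributed according to $\mathcal D_{n,p}$, where $X_j$ is the outcome of the $j$-th trial. For each integer $0\le i\le n$ define $$w_{n,p}(i,m)=\Pr[\forall j\le m\colon \neg(X_j\subsetneq[i])],$$ the probability that no trial produces a proper subset of $[i]=\{1,\dots,i\}$. Then $$w_{n,p}(i,m)=\big(1-(1-p)^{n-i}(1-p^i)\big)^m.$$ Furthermore, for the random multi-hypergraph $\mathcal B_{n,m,p}$ formed by these $m$ samples: (i) $\mathbb E[|\min(\mathcal B_{n,m,p})|]\ge\sum_{i=0}^n\binom ni\big(1-(1-p^i(1-p)^{n-i})^m\big)\cdot w_{n,p}(i,m)$; (ii) $\mathbb E[|\min(\mathcal B_{n,m,p})|]\le\sum_{i=0}^n\binom ni\big(1-(1-p^i(1-p)^{n-i})^m\big)\cdot w_{n,p}(i,m-1)$; (iii) $\mathbb E[|\min(\mathcal B_{n,m,p})|]\le 1+\frac1p\sum_{i=0}^n\binom ni\big(1-(1-p^i(1-p)^{n-i})^m\big)\cdot w_{n,p}(i,m)$.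
   Context: $\mathcal D_{n,p}$ is the distribution on subsets of $[n]$ in which each element of $[n]$ is included independently with probability $p$. The random multi-hypergraph $\mathcal B_{n,m,p}$ on vertex set $[n]$ is the multiset of $m$ independent samples from $\mathcal D_{n,p}$. The minimization $\min(\mathcal H)$ of a multi-hypergraph is the set of its inclusion-wise minimal edges, where a minimal edge occurring with multiplicity is counted once. For $m-1=0$, $w_{n,p}(i,0)=1$ (empty product / no trials).
   Formalization: The probability $p$ takes only rational values with $0<p<1$. -}

module Defs where

open import Data.Nat as ℕ using (ℕ; zero; suc; _∸_; _<ᵇ_)
open import Data.Nat.Combinatorics using (_C_)
open import Data.Bool using (Bool; true; false)
open import Data.Fin using (Fin; toℕ)
open import Data.Fin.Subset using (Subset; inside; outside; _⊂_; ∣_∣)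
open import Data.Fin.Subset.Properties using (_⊂?_)
open import Data.Vec using (Vec; []; _∷_; tabulate; toList)
open import Data.Vec.Relation.Unary.All as VAll using ()
open import Data.Vec.Relation.Unary.Any as VAny using ()
open import Data.Vec.Properties using (≡-dec)
open import Data.Bool.Properties renaming (_≟_ to _≟ᵇ_)
open import Data.List using (List; []; _∷_; map; concatMap; upTo; foldr)
open import Data.Integer using (+_)
open import Data.Rational using (ℚ; 0ℚ; 1ℚ; _+_; _*_; _-_; _/_)
open import Relation.Nullary using (¬_; Dec; yes; no; does)
open import Relation.Nullary.Decidable using (_×-dec_)
open import Data.Product using (_×_)
open import Relation.Nullary.Decidable using (¬?)
open import Relation.Binary.PropositionalEquality using (_≡_)

ℕ→ℚ : ℕ → ℚ
ℕ→ℚ k = + k / 1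

_^ℚ_ : ℚ → ℕ → ℚ
x ^ℚ zero  = 1ℚ
x ^ℚ suc k = x * (x ^ℚ k)

sumℚ : List ℚ → ℚ
sumℚ = foldr _+_ 0ℚ

Σ0to : ℕ → (ℕ → ℚ) → ℚ
Σ0to n f = sumℚ (map f (upTo (suc n)))

𝟙 : ∀ {a} {A : Set a} → Dec A → ℚ
𝟙 d with does d
... | true  = 1ℚ
... | false = 0ℚ

allSubsets : (n : ℕ) → List (Subset n)
allSubsets zero    = [] ∷ []
allSubsets (suc n) = concatMap (λ s → (outside ∷ s) ∷ (inside ∷ s) ∷ []) (allSubsets n)

allTuples : (n m : ℕ) → List (Vec (Subset n) m)
allTuples n zero    = [] ∷ []
allTuples n (suc m) = concatMap (λ X → map (X ∷_) (allTuples n m)) (allSubsets n)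

probSet : (n : ℕ) → ℚ → Subset n → ℚ
probSet n p X = (p ^ℚ ∣ X ∣) * ((1ℚ - p) ^ℚ (n ∸ ∣ X ∣))

probTuple : (n : ℕ) → ℚ → ∀ {m} → Vec (Subset n) m → ℚ
probTuple n p []       = 1ℚ
probTuple n p (X ∷ Xs) = probSet n p X * probTuple n p Xs

𝔼 : (n m : ℕ) → ℚ → (Vec (Subset n) m → ℚ) → ℚ
𝔼 n m p f = sumℚ (map (λ Xs → probTuple n p Xs * f Xs) (allTuples n m))

Pr : (n m : ℕ) → ℚ → {P : Vec (Subset n) m → Set} →
     ((Xs : Vec (Subset n) m) → Dec (P Xs)) → ℚ
Pr n m p P? = 𝔼 n m p (λ Xs → 𝟙 (P? Xs))

-- [i] = {1,…,i} ⊆ [n]; with 0-based Fin n this is {k : toℕ k < i}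
initSeg : (n i : ℕ) → Subset n
initSeg n i = tabulate (λ k → toℕ k <ᵇ i)

w : (n : ℕ) → ℚ → (i m : ℕ) → ℚ
w n p i m = Pr n m p (λ Xs → VAll.all? (λ X → ¬? (X ⊂? initSeg n i)) Xs)

_≟S_ : ∀ {n} (X Y : Subset n) → Dec (X ≡ Y)
_≟S_ = ≡-dec _≟ᵇ_

isMinEdge? : ∀ {n m} (Xs : Vec (Subset n) m) (S : Subset n) →
             Dec (VAny.Any (λ X → X ≡ S) Xs × VAll.All (λ X → ¬ (X ⊂ S)) Xs)
isMinEdge? Xs S = VAny.any? (λ X → X ≟S S) Xs
                  ×-dec VAll.all? (λ X → ¬? (X ⊂? S)) Xs

-- |min(H)|: number of distinct minimal edges (multiplicities counted once)
minCount : ∀ {n m} → Vec (Subset n) m → ℚ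
minCount {n} Xs = sumℚ (map (λ S → 𝟙 (isMinEdge? Xs S)) (allSubsets n))

term : (n m : ℕ) → ℚ → ℕ → ℚ
term n m p i = ℕ→ℚ (n C i) * (1ℚ - (1ℚ - (p ^ℚ i) * ((1ℚ - p) ^ℚ (n ∸ i))) ^ℚ m)

-- S is a minimal edge of X₁,…,Xₘ iff no Xⱼ ⊊ S and some Xⱼ = S. Removing from the first event
-- the part where moreover no Xⱼ = S, i.e. where no Xⱼ ⊆ S, independence gives
-- Pr[S minimal] = aᵐ - bᵐ with a = Pr[¬ X ⊊ S] = 1 - x(1 - y) and b = Pr[X ⊈ S] = 1 - x,
-- where x = (1-p)^(n-|S|) = Pr[X ⊆ S] and xy = p^|S| x = Pr[X = S]. Grouping the sets S by size,
-- 𝔼|min| = Σᵢ C(n,i)(aᵢᵐ - bᵢᵐ), and likewise w(i,m) = aᵢᵐ.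
-- With c = 1 - xy one has a - b = 1 - c and ac - b = x²y(1 - y) ≥ 0, from which
-- (1 - cᵐ)aᵐ ≤ aᵐ - bᵐ ≤ (1 - cᵐ)aᵐ⁻¹: these are (i) and (ii) term by term. For (iii), p ≤ b ≤ a
-- whenever i < n, so aᵐ⁻¹ ≤ aᵐ/p in those terms, while the term i = n is at most 1.

module Submission where

open import Defs
open import Data.Nat as ℕ using (ℕ; _∸_)
open import Data.Product using (_×_)
open import Data.Rational using (ℚ; 0ℚ; 1ℚ; _+_; _*_; _-_; _≤_; _<_; 1/_; >-nonZero)
open import Relation.Binary.PropositionalEquality using (_≡_)

open import Data.Nat using (zero; suc; z≤n; s≤s; s≤s⁻¹)
open import Data.Bool using (Bool; true; false; _∧_; not)
open import Data.Bool.Properties using (∧-identityʳ; ∧-zeroʳ)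
open import Data.Fin.Subset using (Subset; inside; outside; ∣_∣)
open import Data.Fin.Subset.Properties using (_⊂?_; _⊆?_; ⊆-refl; ∣p∣≤n)
open import Data.Integer as ℤ using ()
open import Data.Integer.Properties as ℤ using ()
open import Data.List using (List; []; _∷_; _++_; map; concatMap; upTo)
open import Data.List.Membership.Propositional using (_∈_)
open import Data.List.Membership.Propositional.Properties using (∈-upTo⁻)
open import Data.List.Properties using (map-∘; map-cong; map-applyUpTo; map-upTo; upTo-∷ʳ)
open import Data.List.Relation.Unary.Any using (here; there)
open import Data.Nat.Combinatorics using (_C_; nCk+nC[k+1]≡[n+1]C[k+1]; nCn≡1; k>n⇒nCk≡0)
open import Data.Nat.Properties as ℕ using ()
open import Data.Product using (_,_)
open import Data.Rational using (-_; toℚᵘ; nonNegative; positive)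
open import Data.Rational.Properties as ℚ using ()
open import Data.Rational.Solver using (module +-*-Solver)
open import Data.Rational.Unnormalised as ℚᵘ using (mkℚᵘ; *≡*)
open import Data.Rational.Unnormalised.Properties as ℚᵘ using ()
open import Data.Vec using (Vec; []; _∷_; head; tail)
open import Data.Vec.Relation.Unary.All using (all?)
open import Data.Vec.Relation.Unary.Any using (any?)
open import Function using (_∘_)
open import Relation.Binary.PropositionalEquality
  using (refl; sym; trans; cong; cong₂; subst; subst₂; module ≡-Reasoning)
open import Relation.Nullary using (Dec; does; _because_; yes; no; ¬?; _×-dec_)
open import Relation.Nullary.Decidable using (dec-true)
open import Relation.Unary using (Pred; Decidable)

open +-*-Solver

p≤q⇒0≤q-p : ∀ {p q} → p ≤ q → 0ℚ ≤ q - p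
p≤q⇒0≤q-p {p} {q} p≤q = subst (_≤ q - p) (ℚ.+-inverseʳ p) (ℚ.+-monoˡ-≤ (- p) p≤q)

0≤q-p⇒p≤q : ∀ {p q} → 0ℚ ≤ q - p → p ≤ q
0≤q-p⇒p≤q {p} {q} 0≤q-p = subst₂ _≤_ (ℚ.+-identityˡ p)
  (solve 2 (λ p q → (q :- p) :+ p := q) refl p q) (ℚ.+-monoˡ-≤ p 0≤q-p)

*-mono-≤-nonNeg : ∀ {p q r s} → 0ℚ ≤ p → 0ℚ ≤ r → p ≤ q → r ≤ s → p * r ≤ q * s
*-mono-≤-nonNeg {q = q} {r} 0≤p 0≤r p≤q r≤s = ℚ.≤-trans
  (ℚ.*-monoʳ-≤-nonNeg r {{nonNegative 0≤r}} p≤q)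
  (ℚ.*-monoˡ-≤-nonNeg q {{nonNegative (ℚ.≤-trans 0≤p p≤q)}} r≤s)

0≤p*q : ∀ {p q} → 0ℚ ≤ p → 0ℚ ≤ q → 0ℚ ≤ p * q
0≤p*q = *-mono-≤-nonNeg ℚ.≤-refl ℚ.≤-refl

0≤1/p : ∀ {p} (0<p : 0ℚ < p) → 0ℚ ≤ (1/ p) {{>-nonZero 0<p}}
0≤1/p {p} 0<p = ℚ.<⇒≤ (ℚ.positive⁻¹ _ {{ℚ.1/pos⇒pos p {{positive 0<p}}}})

^ℚ-nonNeg : ∀ {x} k → 0ℚ ≤ x → 0ℚ ≤ x ^ℚ k
^ℚ-nonNeg zero    0≤x = ℚ.nonNegative⁻¹ 1ℚ
^ℚ-nonNeg (suc k) 0≤x = 0≤p*q 0≤x (^ℚ-nonNeg k 0≤x)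

^ℚ-mono-≤ : ∀ {x y} k → 0ℚ ≤ x → x ≤ y → x ^ℚ k ≤ y ^ℚ k
^ℚ-mono-≤ zero    0≤x x≤y = ℚ.≤-refl
^ℚ-mono-≤ (suc k) 0≤x x≤y = *-mono-≤-nonNeg 0≤x (^ℚ-nonNeg k 0≤x) x≤y (^ℚ-mono-≤ k 0≤x x≤y)

^ℚ-≤1 : ∀ {x} k → 0ℚ ≤ x → x ≤ 1ℚ → x ^ℚ k ≤ 1ℚ
^ℚ-≤1 zero    0≤x x≤1 = ℚ.≤-refl
^ℚ-≤1 (suc k) 0≤x x≤1 = *-mono-≤-nonNeg 0≤x (^ℚ-nonNeg k 0≤x) x≤1 (^ℚ-≤1 k 0≤x x≤1)

^ℚ-distrib-* : ∀ x y k → (x * y) ^ℚ k ≡ x ^ℚ k * y ^ℚ k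
^ℚ-distrib-* x y zero    = refl
^ℚ-distrib-* x y (suc k) = trans (cong ((x * y) *_) (^ℚ-distrib-* x y k))
  (solve 4 (λ x y X Y → (x :* y) :* (X :* Y) := (x :* X) :* (y :* Y)) refl x y (x ^ℚ k) (y ^ℚ k))

ℕ→ℚ-nonNeg : ∀ k → 0ℚ ≤ ℕ→ℚ k
ℕ→ℚ-nonNeg k = ℚ.nonNegative⁻¹ (ℕ→ℚ k) {{ℚ.normalize-nonNeg k 1}}

-- ℕ→ℚ k is definitionally fromℚᵘ (mkℚᵘ (+ k) 0).
ℕ→ℚ-+ : ∀ j k → ℕ→ℚ (j ℕ.+ k) ≡ ℕ→ℚ j + ℕ→ℚ k
ℕ→ℚ-+ j k = ℚ.toℚᵘ-injective (begin
    toℚᵘ (ℕ→ℚ (j ℕ.+ k))                ≈⟨ ℚ.toℚᵘ-fromℚᵘ (mkℚᵘ (ℤ.+ (j ℕ.+ k)) 0) ⟩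
    mkℚᵘ (ℤ.+ (j ℕ.+ k)) 0              ≈⟨ *≡* (cong (ℤ._* ℤ.+ 1) +[j+k]≡+j*1++k*1) ⟩
    mkℚᵘ (ℤ.+ j) 0 ℚᵘ.+ mkℚᵘ (ℤ.+ k) 0  ≈⟨ ℚᵘ.+-cong (ℚᵘ.≃-sym (ℚ.toℚᵘ-fromℚᵘ (mkℚᵘ (ℤ.+ j) 0)))
                                                     (ℚᵘ.≃-sym (ℚ.toℚᵘ-fromℚᵘ (mkℚᵘ (ℤ.+ k) 0))) ⟩
    toℚᵘ (ℕ→ℚ j) ℚᵘ.+ toℚᵘ (ℕ→ℚ k)      ≈⟨ ℚᵘ.≃-sym (ℚ.toℚᵘ-homo-+ (ℕ→ℚ j) (ℕ→ℚ k)) ⟩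
    toℚᵘ (ℕ→ℚ j + ℕ→ℚ k)                ∎)
  where
  open ℚᵘ.≃-Reasoning
  +[j+k]≡+j*1++k*1 : ℤ.+ (j ℕ.+ k) ≡ ℤ.+ j ℤ.* ℤ.+ 1 ℤ.+ ℤ.+ k ℤ.* ℤ.+ 1
  +[j+k]≡+j*1++k*1 = trans (ℤ.pos-+ j k) (sym (cong₂ ℤ._+_ (ℤ.*-identityʳ (ℤ.+ j)) (ℤ.*-identityʳ (ℤ.+ k))))

module _ {a b c : ℚ} (0≤b : 0ℚ ≤ b) (b≤ac : b ≤ a * c) where

  ^ℚ-≤-^ℚ*^ℚ : ∀ m → b ^ℚ m ≤ a ^ℚ m * c ^ℚ m
  ^ℚ-≤-^ℚ*^ℚ m = subst (b ^ℚ m ≤_) (^ℚ-distrib-* a c m) (^ℚ-mono-≤ m 0≤b b≤ac)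

  powerGap-lower : ∀ m → (1ℚ - c ^ℚ m) * a ^ℚ m ≤ a ^ℚ m - b ^ℚ m
  powerGap-lower m = 0≤q-p⇒p≤q (subst (0ℚ ≤_)
    (solve 3 (λ A B C → A :* C :- B := (A :- B) :- (con 1ℚ :- C) :* A) refl (a ^ℚ m) (b ^ℚ m) (c ^ℚ m))
    (p≤q⇒0≤q-p (^ℚ-≤-^ℚ*^ℚ m)))

  powerGap-upper : b ≤ a → a - b ≡ 1ℚ - c →
                   ∀ k → a ^ℚ suc k - b ^ℚ suc k ≤ (1ℚ - c ^ℚ suc k) * a ^ℚ k
  powerGap-upper b≤a a-b≡1-c zero = ℚ.≤-reflexive (begin
    a * 1ℚ - b * 1ℚ     ≡⟨ solve 2 (λ a b → a :* con 1ℚ :- b :* con 1ℚ := a :- b) refl a b ⟩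
    a - b               ≡⟨ a-b≡1-c ⟩
    1ℚ - c              ≡⟨ solve 1 (λ c → con 1ℚ :- c := (con 1ℚ :- c :* con 1ℚ) :* con 1ℚ) refl c ⟩
    (1ℚ - c * 1ℚ) * 1ℚ  ∎)
    where open ≡-Reasoning
  powerGap-upper b≤a a-b≡1-c (suc k) = begin
    a * A - b * B
      ≡⟨ solve 4 (λ a b A B → a :* A :- b :* B := a :* (A :- B) :+ (a :- b) :* B) refl a b A B ⟩
    a * (A - B) + (a - b) * B
      ≡⟨ cong (λ d → a * (A - B) + d * B) a-b≡1-c ⟩
    a * (A - B) + (1ℚ - c) * B
      ≤⟨ ℚ.+-mono-≤
           (ℚ.*-monoˡ-≤-nonNeg a {{nonNegative 0≤a}} (powerGap-upper b≤a a-b≡1-c k))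
           (ℚ.*-monoˡ-≤-nonNeg (1ℚ - c) {{nonNegative 0≤1-c}} (^ℚ-≤-^ℚ*^ℚ (suc k))) ⟩
    a * ((1ℚ - C) * a ^ℚ k) + (1ℚ - c) * (A * C)
      ≡⟨ solve 4 (λ a c Aₖ C → a :* ((con 1ℚ :- C) :* Aₖ) :+ (con 1ℚ :- c) :* ((a :* Aₖ) :* C)
                              := (con 1ℚ :- c :* C) :* (a :* Aₖ)) refl a c (a ^ℚ k) C ⟩
    (1ℚ - c * C) * A
      ∎
    where
    open ℚ.≤-Reasoning
    A = a ^ℚ suc k
    B = b ^ℚ suc k
    C = c ^ℚ suc k
    0≤a : 0ℚ ≤ a
    0≤a = ℚ.≤-trans 0≤b b≤a
    0≤1-c : 0ℚ ≤ 1ℚ - c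
    0≤1-c = subst (0ℚ ≤_) a-b≡1-c (p≤q⇒0≤q-p b≤a)

powerGap-≤1 : ∀ {a b} m → 0ℚ ≤ a → a ≤ 1ℚ → 0ℚ ≤ b → a ^ℚ m - b ^ℚ m ≤ 1ℚ
powerGap-≤1 {a} {b} m 0≤a a≤1 0≤b = ℚ.≤-trans
  (0≤q-p⇒p≤q (subst (0ℚ ≤_) (solve 2 (λ A B → B := A :- (A :- B)) refl (a ^ℚ m) (b ^ℚ m)) (^ℚ-nonNeg m 0≤b)))
  (^ℚ-≤1 m 0≤a a≤1)

Σl : {A : Set} → List A → (A → ℚ) → ℚ
Σl xs f = sumℚ (map f xs)

module _ {A : Set} where

  Σl-cong : (xs : List A) {f g : A → ℚ} → (∀ x → f x ≡ g x) → Σl xs f ≡ Σl xs g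
  Σl-cong xs f≗g = cong sumℚ (map-cong f≗g xs)

  Σl-mono : (xs : List A) {f g : A → ℚ} → (∀ x → x ∈ xs → f x ≤ g x) → Σl xs f ≤ Σl xs g
  Σl-mono []       f≤g = ℚ.≤-refl
  Σl-mono (x ∷ xs) f≤g = ℚ.+-mono-≤ (f≤g x (here refl)) (Σl-mono xs (λ y y∈xs → f≤g y (there y∈xs)))

  Σl-++ : (xs ys : List A) (f : A → ℚ) → Σl (xs ++ ys) f ≡ Σl xs f + Σl ys f
  Σl-++ []       ys f = sym (ℚ.+-identityˡ (Σl ys f))
  Σl-++ (x ∷ xs) ys f = trans (cong (f x +_) (Σl-++ xs ys f)) (sym (ℚ.+-assoc (f x) _ _))

  Σl-zero : (xs : List A) → Σl xs (λ _ → 0ℚ) ≡ 0ℚ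
  Σl-zero []       = refl
  Σl-zero (x ∷ xs) = trans (ℚ.+-identityˡ _) (Σl-zero xs)

  Σl-+ : (xs : List A) (f g : A → ℚ) → Σl xs (λ x → f x + g x) ≡ Σl xs f + Σl xs g
  Σl-+ []       f g = refl
  Σl-+ (x ∷ xs) f g = trans (cong (f x + g x +_) (Σl-+ xs f g))
    (solve 4 (λ a b c d → (a :+ b) :+ (c :+ d) := (a :+ c) :+ (b :+ d)) refl (f x) (g x) (Σl xs f) (Σl xs g))

  Σl-sub : (xs : List A) (f g : A → ℚ) → Σl xs (λ x → f x - g x) ≡ Σl xs f - Σl xs g
  Σl-sub []       f g = refl
  Σl-sub (x ∷ xs) f g = trans (cong (f x - g x +_) (Σl-sub xs f g))
    (solve 4 (λ a b c d → (a :- b) :+ (c :- d) := (a :+ c) :- (b :+ d)) refl (f x) (g x) (Σl xs f) (Σl xs g))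

  Σl-*ˡ : (xs : List A) (c : ℚ) (f : A → ℚ) → Σl xs (λ x → c * f x) ≡ c * Σl xs f
  Σl-*ˡ []       c f = sym (ℚ.*-zeroʳ c)
  Σl-*ˡ (x ∷ xs) c f = trans (cong (c * f x +_) (Σl-*ˡ xs c f)) (sym (ℚ.*-distribˡ-+ c (f x) _))

  Σl-*ʳ : (xs : List A) (c : ℚ) (f : A → ℚ) → Σl xs (λ x → f x * c) ≡ Σl xs f * c
  Σl-*ʳ xs c f = trans (Σl-cong xs (λ x → ℚ.*-comm (f x) c)) (trans (Σl-*ˡ xs c f) (ℚ.*-comm c _))

module _ {A B : Set} where

  Σl-map : (xs : List A) (g : A → B) (f : B → ℚ) → Σl (map g xs) f ≡ Σl xs (f ∘ g)
  Σl-map xs g f = cong sumℚ (sym (map-∘ xs))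

  Σl-concatMap : (xs : List A) (g : A → List B) (f : B → ℚ) →
                 Σl (concatMap g xs) f ≡ Σl xs (λ x → Σl (g x) f)
  Σl-concatMap []       g f = refl
  Σl-concatMap (x ∷ xs) g f =
    trans (Σl-++ (g x) (concatMap g xs) f) (cong (Σl (g x) f +_) (Σl-concatMap xs g f))

  Σl-swap : (xs : List A) (ys : List B) (F : A → B → ℚ) →
            Σl xs (λ x → Σl ys (F x)) ≡ Σl ys (λ y → Σl xs (λ x → F x y))
  Σl-swap []       ys F = sym (Σl-zero ys)
  Σl-swap (x ∷ xs) ys F = trans (cong (Σl ys (F x) +_) (Σl-swap xs ys F))
    (sym (Σl-+ ys (F x) (λ y → Σl xs (λ x → F x y))))

Σ0to-suc : ∀ n (f : ℕ → ℚ) → Σ0to (suc n) f ≡ f 0 + Σ0to n (f ∘ suc)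
Σ0to-suc n f = cong (λ xs → f 0 + sumℚ xs)
  (trans (map-applyUpTo suc f (suc n)) (sym (map-upTo (f ∘ suc) (suc n))))

Σ0to-last : ∀ n (f : ℕ → ℚ) → Σ0to (suc n) f ≡ Σ0to n f + f (suc n)
Σ0to-last n f = begin
  Σl (upTo (suc (suc n))) f          ≡⟨ cong (λ xs → Σl xs f) (sym (upTo-∷ʳ (suc n))) ⟩
  Σl (upTo (suc n) ++ suc n ∷ []) f  ≡⟨ Σl-++ (upTo (suc n)) (suc n ∷ []) f ⟩
  Σ0to n f + (f (suc n) + 0ℚ)        ≡⟨ cong (Σ0to n f +_) (ℚ.+-identityʳ (f (suc n))) ⟩
  Σ0to n f + f (suc n)               ∎
  where open ≡-Reasoning

Σ0to-mono : ∀ n {f g : ℕ → ℚ} → (∀ i → i ℕ.≤ n → f i ≤ g i) → Σ0to n f ≤ Σ0to n g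
Σ0to-mono n f≤g = Σl-mono (upTo (suc n)) (λ i i∈ → f≤g i (s≤s⁻¹ (∈-upTo⁻ i∈)))

Σ0to-≤-1+r*Σ0to : ∀ n {f g : ℕ → ℚ} r → (∀ i → i ℕ.≤ n → f i ≤ r * g i) → f (suc n) ≤ 1ℚ →
                  0ℚ ≤ r * g (suc n) → Σ0to (suc n) f ≤ 1ℚ + r * Σ0to (suc n) g
Σ0to-≤-1+r*Σ0to n {f} {g} r f≤rg fₙ≤1 0≤rgₙ = begin
  Σ0to (suc n) f
    ≡⟨ Σ0to-last n f ⟩
  Σ0to n f + f (suc n)
    ≤⟨ ℚ.+-mono-≤ (Σ0to-mono n f≤rg) fₙ≤1 ⟩
  Σ0to n (λ i → r * g i) + 1ℚ
    ≡⟨ cong (_+ 1ℚ) (Σl-*ˡ (upTo (suc n)) r g) ⟩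
  r * Σ0to n g + 1ℚ
    ≤⟨ ℚ.+-monoˡ-≤ 1ℚ (subst (_≤ r * Σ0to n g + r * g (suc n)) (ℚ.+-identityʳ (r * Σ0to n g))
                      (ℚ.+-monoʳ-≤ (r * Σ0to n g) 0≤rgₙ)) ⟩
  r * Σ0to n g + r * g (suc n) + 1ℚ
    ≡⟨ solve 3 (λ r s t → r :* s :+ r :* t :+ con 1ℚ := con 1ℚ :+ r :* (s :+ t)) refl r (Σ0to n g) (g (suc n)) ⟩
  1ℚ + r * (Σ0to n g + g (suc n))
    ≡⟨ cong (λ s → 1ℚ + r * s) (sym (Σ0to-last n g)) ⟩
  1ℚ + r * Σ0to (suc n) g
    ∎
  where open ℚ.≤-Reasoning

binomialSum : ℕ → (ℕ → ℚ) → ℚ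
binomialSum n h = Σ0to n (λ i → ℕ→ℚ (n C i) * h i)

binomialSum-shift : ∀ n h → binomialSum n h ≡ h 0 + Σ0to n (λ i → ℕ→ℚ (n C suc i) * h (suc i))
binomialSum-shift n h = begin
  binomialSum n h
    ≡⟨ sym (ℚ.+-identityʳ _) ⟩
  binomialSum n h + 0ℚ
    ≡⟨ cong (binomialSum n h +_) (sym (ℚ.*-zeroˡ (h (suc n)))) ⟩
  binomialSum n h + ℕ→ℚ 0 * h (suc n)
    ≡⟨ cong (λ k → binomialSum n h + ℕ→ℚ k * h (suc n)) (sym (k>n⇒nCk≡0 (ℕ.n<1+n n))) ⟩
  binomialSum n h + ℕ→ℚ (n C suc n) * h (suc n)
    ≡⟨ sym (Σ0to-last n (λ i → ℕ→ℚ (n C i) * h i)) ⟩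
  Σ0to (suc n) (λ i → ℕ→ℚ (n C i) * h i)
    ≡⟨ Σ0to-suc n (λ i → ℕ→ℚ (n C i) * h i) ⟩
  1ℚ * h 0 + Σ0to n (λ i → ℕ→ℚ (n C suc i) * h (suc i))
    ≡⟨ cong (_+ Σ0to n (λ i → ℕ→ℚ (n C suc i) * h (suc i))) (ℚ.*-identityˡ (h 0)) ⟩
  h 0 + Σ0to n (λ i → ℕ→ℚ (n C suc i) * h (suc i))
    ∎
  where open ≡-Reasoning

binomialSum-suc : ∀ n h → binomialSum (suc n) h ≡ binomialSum n h + binomialSum n (h ∘ suc)
binomialSum-suc n h = begin
  binomialSum (suc n) h
    ≡⟨ Σ0to-suc n (λ i → ℕ→ℚ (suc n C i) * h i) ⟩
  1ℚ * h 0 + Σ0to n (λ i → ℕ→ℚ (suc n C suc i) * h (suc i))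
    ≡⟨ cong₂ _+_ (ℚ.*-identityˡ (h 0)) (Σl-cong (upTo (suc n)) pascal) ⟩
  h 0 + Σ0to n (λ i → ℕ→ℚ (n C i) * h (suc i) + R i)
    ≡⟨ cong (h 0 +_) (Σl-+ (upTo (suc n)) (λ i → ℕ→ℚ (n C i) * h (suc i)) R) ⟩
  h 0 + (binomialSum n (h ∘ suc) + Σ0to n R)
    ≡⟨ solve 3 (λ a b c → a :+ (b :+ c) := (a :+ c) :+ b) refl (h 0) _ (Σ0to n R) ⟩
  (h 0 + Σ0to n R) + binomialSum n (h ∘ suc)
    ≡⟨ cong (_+ binomialSum n (h ∘ suc)) (sym (binomialSum-shift n h)) ⟩
  binomialSum n h + binomialSum n (h ∘ suc)
    ∎
  where
  open ≡-Reasoning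
  R : ℕ → ℚ
  R i = ℕ→ℚ (n C suc i) * h (suc i)
  pascal : ∀ i → ℕ→ℚ (suc n C suc i) * h (suc i) ≡ ℕ→ℚ (n C i) * h (suc i) + R i
  pascal i = trans (cong (λ k → ℕ→ℚ k * h (suc i)) (sym (nCk+nC[k+1]≡[n+1]C[k+1] n i)))
    (trans (cong (_* h (suc i)) (ℕ→ℚ-+ (n C i) (n C suc i)))
           (ℚ.*-distribʳ-+ (h (suc i)) (ℕ→ℚ (n C i)) (ℕ→ℚ (n C suc i))))

Σl-allSubsets-suc : ∀ n (f : Subset (suc n) → ℚ) →
  Σl (allSubsets (suc n)) f ≡ Σl (allSubsets n) (λ X → f (outside ∷ X) + f (inside ∷ X))
Σl-allSubsets-suc n f = trans (Σl-concatMap (allSubsets n) _ f)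
  (Σl-cong (allSubsets n) (λ X → cong (f (outside ∷ X) +_) (ℚ.+-identityʳ (f (inside ∷ X)))))

Σl-allSubsets-∣∣ : ∀ n (h : ℕ → ℚ) → Σl (allSubsets n) (λ S → h ∣ S ∣) ≡ binomialSum n h
Σl-allSubsets-∣∣ zero    h = cong (_+ 0ℚ) (sym (ℚ.*-identityˡ (h 0)))
Σl-allSubsets-∣∣ (suc n) h = begin
  Σl (allSubsets (suc n)) (λ S → h ∣ S ∣)
    ≡⟨ Σl-allSubsets-suc n (λ S → h ∣ S ∣) ⟩
  Σl (allSubsets n) (λ X → h ∣ X ∣ + h (suc ∣ X ∣))
    ≡⟨ Σl-+ (allSubsets n) _ _ ⟩
  Σl (allSubsets n) (λ X → h ∣ X ∣) + Σl (allSubsets n) (λ X → h (suc ∣ X ∣))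
    ≡⟨ cong₂ _+_ (Σl-allSubsets-∣∣ n h) (Σl-allSubsets-∣∣ n (h ∘ suc)) ⟩
  binomialSum n h + binomialSum n (h ∘ suc)
    ≡⟨ sym (binomialSum-suc n h) ⟩
  binomialSum (suc n) h
    ∎
  where open ≡-Reasoning

𝟙ᵇ : Bool → ℚ
𝟙ᵇ true  = 1ℚ
𝟙ᵇ false = 0ℚ

𝟙≡𝟙ᵇ∘does : ∀ {a} {A : Set a} (d : Dec A) → 𝟙 d ≡ 𝟙ᵇ (does d)
𝟙≡𝟙ᵇ∘does (true  because _) = refl
𝟙≡𝟙ᵇ∘does (false because _) = refl

𝟙ᵇ-∧ : ∀ a b → 𝟙ᵇ (a ∧ b) ≡ 𝟙ᵇ a * 𝟙ᵇ b
𝟙ᵇ-∧ true  b = sym (ℚ.*-identityˡ (𝟙ᵇ b))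
𝟙ᵇ-∧ false b = sym (ℚ.*-zeroˡ (𝟙ᵇ b))

𝟙ᵇ[b∧a]≡𝟙ᵇa-𝟙ᵇ[a∧¬b] : ∀ b a → 𝟙ᵇ (b ∧ a) ≡ 𝟙ᵇ a - 𝟙ᵇ (a ∧ not b)
𝟙ᵇ[b∧a]≡𝟙ᵇa-𝟙ᵇ[a∧¬b] true  true  = refl
𝟙ᵇ[b∧a]≡𝟙ᵇa-𝟙ᵇ[a∧¬b] true  false = refl
𝟙ᵇ[b∧a]≡𝟙ᵇa-𝟙ᵇ[a∧¬b] false true  = refl
𝟙ᵇ[b∧a]≡𝟙ᵇa-𝟙ᵇ[a∧¬b] false false = refl

module _ {a ℓ₁ ℓ₂} {A : Set a} {P : Pred A ℓ₁} {Q : Pred A ℓ₂} (P? : Decidable P) (Q? : Decidable Q) where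

  does-all?-×-¬any? : ∀ {m} (xs : Vec A m) →
    does (all? (λ x → P? x ×-dec ¬? (Q? x)) xs) ≡ does (all? P? xs) ∧ not (does (any? Q? xs))
  does-all?-×-¬any? []       = refl
  does-all?-×-¬any? (x ∷ xs) rewrite does-all?-×-¬any? xs with does (P? x) | does (Q? x)
  ... | false | _     = refl
  ... | true  | true  = sym (∧-zeroʳ _)
  ... | true  | false = refl

does-⊂? : ∀ {n} (X S : Subset n) → does (X ⊂? S) ≡ does (X ⊆? S) ∧ not (does (X ≟S S))
does-⊂? []            []            = refl
does-⊂? (outside ∷ X) (outside ∷ S) = does-⊂? X S
does-⊂? (outside ∷ X) (inside  ∷ S) = sym (∧-identityʳ (does (X ⊆? S)))
does-⊂? (inside  ∷ X) (outside ∷ S) = refl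
does-⊂? (inside  ∷ X) (inside  ∷ S) = does-⊂? X S

𝟙ᵇ-¬⊂ : ∀ {n} (X S : Subset n) →
  𝟙ᵇ (not (does (X ⊂? S))) ≡ 1ℚ - 𝟙ᵇ (does (X ⊆? S)) + 𝟙ᵇ (does (X ≟S S))
𝟙ᵇ-¬⊂ X S rewrite does-⊂? X S with X ≟S S
... | yes refl rewrite dec-true (X ⊆? X) ⊆-refl = refl
... | no _ with does (X ⊆? S)
...   | true  = refl
...   | false = refl

𝟙ᵇ-¬⊂∧≢ : ∀ {n} (X S : Subset n) →
  𝟙ᵇ (not (does (X ⊂? S)) ∧ not (does (X ≟S S))) ≡ 1ℚ - 𝟙ᵇ (does (X ⊆? S))
𝟙ᵇ-¬⊂∧≢ X S rewrite does-⊂? X S with X ≟S S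
... | yes refl rewrite dec-true (X ⊆? X) ⊆-refl = refl
... | no _ with does (X ⊆? S)
...   | true  = refl
...   | false = refl

module _ (p : ℚ) where

  probSet-outside : ∀ {n} (X : Subset n) → probSet (suc n) p (outside ∷ X) ≡ (1ℚ - p) * probSet n p X
  probSet-outside {n} X = begin
    P * q ^ℚ (suc n ∸ ∣ X ∣)
      ≡⟨ cong (λ k → P * q ^ℚ k) (ℕ.+-∸-assoc 1 (∣p∣≤n X)) ⟩
    P * (q * q ^ℚ (n ∸ ∣ X ∣))
      ≡⟨ solve 3 (λ P q Q → P :* (q :* Q) := q :* (P :* Q)) refl P q (q ^ℚ (n ∸ ∣ X ∣)) ⟩
    q * probSet n p X
      ∎
    where
    open ≡-Reasoning
    P = p ^ℚ ∣ X ∣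
    q = 1ℚ - p

  probSet-inside : ∀ {n} (X : Subset n) → probSet (suc n) p (inside ∷ X) ≡ p * probSet n p X
  probSet-inside X = ℚ.*-assoc p _ _

𝔼₁ : (n : ℕ) → ℚ → (Subset n → ℚ) → ℚ
𝔼₁ n p f = Σl (allSubsets n) (λ X → probSet n p X * f X)

module _ {n : ℕ} {p : ℚ} where

  𝔼₁-cong : {f g : Subset n → ℚ} → (∀ X → f X ≡ g X) → 𝔼₁ n p f ≡ 𝔼₁ n p g
  𝔼₁-cong f≗g = Σl-cong (allSubsets n) (λ X → cong (probSet n p X *_) (f≗g X))

  𝔼₁-+ : (f g : Subset n → ℚ) → 𝔼₁ n p (λ X → f X + g X) ≡ 𝔼₁ n p f + 𝔼₁ n p g
  𝔼₁-+ f g = trans (Σl-cong (allSubsets n) (λ X → ℚ.*-distribˡ-+ (probSet n p X) (f X) (g X)))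
                   (Σl-+ (allSubsets n) _ _)

  𝔼₁-sub : (f g : Subset n → ℚ) → 𝔼₁ n p (λ X → f X - g X) ≡ 𝔼₁ n p f - 𝔼₁ n p g
  𝔼₁-sub f g = trans (Σl-cong (allSubsets n) (λ X →
      solve 3 (λ P a b → P :* (a :- b) := P :* a :- P :* b) refl (probSet n p X) (f X) (g X)))
    (Σl-sub (allSubsets n) _ _)

𝔼₁-suc : ∀ n p (f : Subset (suc n) → ℚ) →
  𝔼₁ (suc n) p f ≡ (1ℚ - p) * 𝔼₁ n p (f ∘ (outside ∷_)) + p * 𝔼₁ n p (f ∘ (inside ∷_))
𝔼₁-suc n p f = begin
  𝔼₁ (suc n) p f
    ≡⟨ Σl-allSubsets-suc n _ ⟩
  Σl Ss (λ X → P (outside ∷ X) * f₀ X + P (inside ∷ X) * f₁ X)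
    ≡⟨ Σl-cong Ss (λ X → cong₂ _+_
         (trans (cong (_* f₀ X) (probSet-outside p X)) (ℚ.*-assoc (1ℚ - p) _ _))
         (trans (cong (_* f₁ X) (probSet-inside p X)) (ℚ.*-assoc p _ _))) ⟩
  Σl Ss (λ X → (1ℚ - p) * (Pₙ X * f₀ X) + p * (Pₙ X * f₁ X))
    ≡⟨ Σl-+ Ss _ _ ⟩
  Σl Ss (λ X → (1ℚ - p) * (Pₙ X * f₀ X)) + Σl Ss (λ X → p * (Pₙ X * f₁ X))
    ≡⟨ cong₂ _+_ (Σl-*ˡ Ss (1ℚ - p) _) (Σl-*ˡ Ss p _) ⟩
  (1ℚ - p) * 𝔼₁ n p f₀ + p * 𝔼₁ n p f₁
    ∎
  where
  open ≡-Reasoning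
  Ss = allSubsets n
  P = probSet (suc n) p
  Pₙ = probSet n p
  f₀ f₁ : Subset n → ℚ
  f₀ = f ∘ (outside ∷_)
  f₁ = f ∘ (inside ∷_)

𝔼₁-const : ∀ n p c → 𝔼₁ n p (λ _ → c) ≡ c
𝔼₁-const zero    p c = trans (ℚ.+-identityʳ _) (ℚ.*-identityˡ c)
𝔼₁-const (suc n) p c = begin
  𝔼₁ (suc n) p (λ _ → c)
    ≡⟨ 𝔼₁-suc n p (λ _ → c) ⟩
  (1ℚ - p) * 𝔼₁ n p (λ _ → c) + p * 𝔼₁ n p (λ _ → c)
    ≡⟨ cong (λ e → (1ℚ - p) * e + p * e) (𝔼₁-const n p c) ⟩
  (1ℚ - p) * c + p * c
    ≡⟨ solve 2 (λ p c → (con 1ℚ :- p) :* c :+ p :* c := c) refl p c ⟩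
  c
    ∎
  where open ≡-Reasoning

𝔼₁-⊆ : ∀ {n} p (T : Subset n) → 𝔼₁ n p (λ X → 𝟙ᵇ (does (X ⊆? T))) ≡ (1ℚ - p) ^ℚ (n ∸ ∣ T ∣)
𝔼₁-⊆ p [] = refl
𝔼₁-⊆ {suc n} p (inside ∷ T) = begin
  𝔼₁ (suc n) p (λ X → 𝟙ᵇ (does (X ⊆? (inside ∷ T))))
    ≡⟨ 𝔼₁-suc n p (λ X → 𝟙ᵇ (does (X ⊆? (inside ∷ T)))) ⟩
  (1ℚ - p) * E + p * E
    ≡⟨ solve 2 (λ p E → (con 1ℚ :- p) :* E :+ p :* E := E) refl p E ⟩
  E
    ≡⟨ 𝔼₁-⊆ p T ⟩
  (1ℚ - p) ^ℚ (n ∸ ∣ T ∣)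
    ∎
  where
  open ≡-Reasoning
  E = 𝔼₁ n p (λ X → 𝟙ᵇ (does (X ⊆? T)))
𝔼₁-⊆ {suc n} p (outside ∷ T) = begin
  𝔼₁ (suc n) p (λ X → 𝟙ᵇ (does (X ⊆? (outside ∷ T))))
    ≡⟨ 𝔼₁-suc n p (λ X → 𝟙ᵇ (does (X ⊆? (outside ∷ T)))) ⟩
  (1ℚ - p) * 𝔼₁ n p (λ X → 𝟙ᵇ (does (X ⊆? T))) + p * 𝔼₁ n p (λ _ → 0ℚ)
    ≡⟨ cong₂ (λ e z → (1ℚ - p) * e + p * z) (𝔼₁-⊆ p T) (𝔼₁-const n p 0ℚ) ⟩
  (1ℚ - p) * (1ℚ - p) ^ℚ (n ∸ ∣ T ∣) + p * 0ℚ
    ≡⟨ solve 2 (λ p Q → (con 1ℚ :- p) :* Q :+ p :* con 0ℚ := (con 1ℚ :- p) :* Q) refl p _ ⟩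
  (1ℚ - p) ^ℚ suc (n ∸ ∣ T ∣)
    ≡⟨ cong ((1ℚ - p) ^ℚ_) (sym (ℕ.+-∸-assoc 1 (∣p∣≤n T))) ⟩
  (1ℚ - p) ^ℚ (suc n ∸ ∣ T ∣)
    ∎
  where open ≡-Reasoning

𝔼₁-≟ : ∀ {n} p (T : Subset n) → 𝔼₁ n p (λ X → 𝟙ᵇ (does (X ≟S T))) ≡ probSet n p T
𝔼₁-≟ p [] = refl
𝔼₁-≟ {suc n} p (inside ∷ T) = begin
  𝔼₁ (suc n) p (λ X → 𝟙ᵇ (does (X ≟S (inside ∷ T))))
    ≡⟨ 𝔼₁-suc n p (λ X → 𝟙ᵇ (does (X ≟S (inside ∷ T)))) ⟩
  (1ℚ - p) * 𝔼₁ n p (λ _ → 0ℚ) + p * 𝔼₁ n p (λ X → 𝟙ᵇ (does (X ≟S T)))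
    ≡⟨ cong₂ (λ z e → (1ℚ - p) * z + p * e) (𝔼₁-const n p 0ℚ) (𝔼₁-≟ p T) ⟩
  (1ℚ - p) * 0ℚ + p * probSet n p T
    ≡⟨ solve 2 (λ p P → (con 1ℚ :- p) :* con 0ℚ :+ p :* P := p :* P) refl p _ ⟩
  p * probSet n p T
    ≡⟨ sym (probSet-inside p T) ⟩
  probSet (suc n) p (inside ∷ T)
    ∎
  where open ≡-Reasoning
𝔼₁-≟ {suc n} p (outside ∷ T) = begin
  𝔼₁ (suc n) p (λ X → 𝟙ᵇ (does (X ≟S (outside ∷ T))))
    ≡⟨ 𝔼₁-suc n p (λ X → 𝟙ᵇ (does (X ≟S (outside ∷ T)))) ⟩
  (1ℚ - p) * 𝔼₁ n p (λ X → 𝟙ᵇ (does (X ≟S T))) + p * 𝔼₁ n p (λ _ → 0ℚ)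
    ≡⟨ cong₂ (λ e z → (1ℚ - p) * e + p * z) (𝔼₁-≟ p T) (𝔼₁-const n p 0ℚ) ⟩
  (1ℚ - p) * probSet n p T + p * 0ℚ
    ≡⟨ solve 2 (λ p P → (con 1ℚ :- p) :* P :+ p :* con 0ℚ := (con 1ℚ :- p) :* P) refl p _ ⟩
  (1ℚ - p) * probSet n p T
    ≡⟨ sym (probSet-outside p T) ⟩
  probSet (suc n) p (outside ∷ T)
    ∎
  where open ≡-Reasoning

-- For |S| = i and X ∼ D_{n,p}: Pr[¬ X ⊊ S], Pr[X ⊈ S] and Pr[X ≠ S].
pr¬⊂ pr¬⊆ pr≢ : ℕ → ℚ → ℕ → ℚ
pr¬⊂ n p i = 1ℚ - (1ℚ - p) ^ℚ (n ∸ i) * (1ℚ - p ^ℚ i)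
pr¬⊆ n p i = 1ℚ - (1ℚ - p) ^ℚ (n ∸ i)
pr≢  n p i = 1ℚ - p ^ℚ i * (1ℚ - p) ^ℚ (n ∸ i)

module _ {n : ℕ} (p : ℚ) (S : Subset n) where

  𝔼₁-¬⊂ : 𝔼₁ n p (λ X → 𝟙ᵇ (not (does (X ⊂? S)))) ≡ pr¬⊂ n p ∣ S ∣
  𝔼₁-¬⊂ = begin
    𝔼₁ n p (λ X → 𝟙ᵇ (not (does (X ⊂? S))))
      ≡⟨ 𝔼₁-cong (λ X → 𝟙ᵇ-¬⊂ X S) ⟩
    𝔼₁ n p (λ X → 1ℚ - 𝟙ᵇ (does (X ⊆? S)) + 𝟙ᵇ (does (X ≟S S)))
      ≡⟨ 𝔼₁-+ (λ X → 1ℚ - 𝟙ᵇ (does (X ⊆? S))) (λ X → 𝟙ᵇ (does (X ≟S S))) ⟩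
    𝔼₁ n p (λ X → 1ℚ - 𝟙ᵇ (does (X ⊆? S))) + 𝔼₁ n p (λ X → 𝟙ᵇ (does (X ≟S S)))
      ≡⟨ cong₂ _+_ (𝔼₁-sub (λ _ → 1ℚ) (λ X → 𝟙ᵇ (does (X ⊆? S)))) (𝔼₁-≟ p S) ⟩
    𝔼₁ n p (λ _ → 1ℚ) - 𝔼₁ n p (λ X → 𝟙ᵇ (does (X ⊆? S))) + probSet n p S
      ≡⟨ cong₂ (λ u v → u - v + probSet n p S) (𝔼₁-const n p 1ℚ) (𝔼₁-⊆ p S) ⟩
    1ℚ - x + y * x
      ≡⟨ solve 2 (λ x y → con 1ℚ :- x :+ y :* x := con 1ℚ :- x :* (con 1ℚ :- y)) refl x y ⟩
    pr¬⊂ n p ∣ S ∣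
      ∎
    where
    open ≡-Reasoning
    x = (1ℚ - p) ^ℚ (n ∸ ∣ S ∣)
    y = p ^ℚ ∣ S ∣

  𝔼₁-¬⊂∧≢ : 𝔼₁ n p (λ X → 𝟙ᵇ (not (does (X ⊂? S)) ∧ not (does (X ≟S S)))) ≡ pr¬⊆ n p ∣ S ∣
  𝔼₁-¬⊂∧≢ = begin
    𝔼₁ n p (λ X → 𝟙ᵇ (not (does (X ⊂? S)) ∧ not (does (X ≟S S))))
      ≡⟨ 𝔼₁-cong (λ X → 𝟙ᵇ-¬⊂∧≢ X S) ⟩
    𝔼₁ n p (λ X → 1ℚ - 𝟙ᵇ (does (X ⊆? S)))
      ≡⟨ 𝔼₁-sub (λ _ → 1ℚ) (λ X → 𝟙ᵇ (does (X ⊆? S))) ⟩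
    𝔼₁ n p (λ _ → 1ℚ) - 𝔼₁ n p (λ X → 𝟙ᵇ (does (X ⊆? S)))
      ≡⟨ cong₂ _-_ (𝔼₁-const n p 1ℚ) (𝔼₁-⊆ p S) ⟩
    pr¬⊆ n p ∣ S ∣
      ∎
    where open ≡-Reasoning

module _ {n : ℕ} (p : ℚ) where

  𝔼-cong : ∀ m {f g : Vec (Subset n) m → ℚ} → (∀ Xs → f Xs ≡ g Xs) → 𝔼 n m p f ≡ 𝔼 n m p g
  𝔼-cong m f≗g = Σl-cong (allTuples n m) (λ Xs → cong (probTuple n p Xs *_) (f≗g Xs))

  𝔼-sub : ∀ m (f g : Vec (Subset n) m → ℚ) → 𝔼 n m p (λ Xs → f Xs - g Xs) ≡ 𝔼 n m p f - 𝔼 n m p g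
  𝔼-sub m f g = trans (Σl-cong (allTuples n m) (λ Xs →
      solve 3 (λ P a b → P :* (a :- b) := P :* a :- P :* b) refl (probTuple n p Xs) (f Xs) (g Xs)))
    (Σl-sub (allTuples n m) _ _)

  𝔼-Σl : ∀ m {B : Set} (ys : List B) (F : Vec (Subset n) m → B → ℚ) →
         𝔼 n m p (λ Xs → Σl ys (F Xs)) ≡ Σl ys (λ y → 𝔼 n m p (λ Xs → F Xs y))
  𝔼-Σl m ys F = trans
    (Σl-cong (allTuples n m) (λ Xs → sym (Σl-*ˡ ys (probTuple n p Xs) (F Xs))))
    (Σl-swap (allTuples n m) ys (λ Xs y → probTuple n p Xs * F Xs y))

  𝔼-head*tail : ∀ m (f : Subset n → ℚ) (g : Vec (Subset n) m → ℚ) →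
                𝔼 n (suc m) p (λ Xs → f (head Xs) * g (tail Xs)) ≡ 𝔼₁ n p f * 𝔼 n m p g
  𝔼-head*tail m f g = begin
    𝔼 n (suc m) p (λ Xs → f (head Xs) * g (tail Xs))
      ≡⟨ Σl-concatMap Ss (λ X → map (X ∷_) Ts) _ ⟩
    Σl Ss (λ X → Σl (map (X ∷_) Ts) (λ Xs → probTuple n p Xs * (f (head Xs) * g (tail Xs))))
      ≡⟨ Σl-cong Ss (λ X → Σl-map Ts (X ∷_) _) ⟩
    Σl Ss (λ X → Σl Ts (λ Xs → probSet n p X * probTuple n p Xs * (f X * g Xs)))
      ≡⟨ Σl-cong Ss (λ X → Σl-cong Ts (λ Xs →
           solve 4 (λ P Q a b → P :* Q :* (a :* b) := (P :* a) :* (Q :* b))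
             refl (probSet n p X) (probTuple n p Xs) (f X) (g Xs))) ⟩
    Σl Ss (λ X → Σl Ts (λ Xs → (probSet n p X * f X) * (probTuple n p Xs * g Xs)))
      ≡⟨ Σl-cong Ss (λ X → Σl-*ˡ Ts (probSet n p X * f X) _) ⟩
    Σl Ss (λ X → (probSet n p X * f X) * 𝔼 n m p g)
      ≡⟨ Σl-*ʳ Ss (𝔼 n m p g) _ ⟩
    𝔼₁ n p f * 𝔼 n m p g
      ∎
    where
    open ≡-Reasoning
    Ss = allSubsets n
    Ts = allTuples n m

  𝔼-all? : ∀ {ℓ} {P : Pred (Subset n) ℓ} (P? : Decidable P) m →
           𝔼 n m p (λ Xs → 𝟙ᵇ (does (all? P? Xs))) ≡ 𝔼₁ n p (λ X → 𝟙ᵇ (does (P? X))) ^ℚ m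
  𝔼-all? P? zero    = trans (ℚ.+-identityʳ _) (ℚ.*-identityˡ 1ℚ)
  𝔼-all? P? (suc m) = begin
    𝔼 n (suc m) p (λ Xs → 𝟙ᵇ (does (all? P? Xs)))
      ≡⟨ 𝔼-cong (suc m) (λ { (X ∷ Xs) → 𝟙ᵇ-∧ (does (P? X)) (does (all? P? Xs)) }) ⟩
    𝔼 n (suc m) p (λ Xs → 𝟙ᵇ (does (P? (head Xs))) * 𝟙ᵇ (does (all? P? (tail Xs))))
      ≡⟨ 𝔼-head*tail m (λ X → 𝟙ᵇ (does (P? X))) (λ Xs → 𝟙ᵇ (does (all? P? Xs))) ⟩
    𝔼₁ n p (λ X → 𝟙ᵇ (does (P? X))) * 𝔼 n m p (λ Xs → 𝟙ᵇ (does (all? P? Xs)))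
      ≡⟨ cong (𝔼₁ n p (λ X → 𝟙ᵇ (does (P? X))) *_) (𝔼-all? P? m) ⟩
    𝔼₁ n p (λ X → 𝟙ᵇ (does (P? X))) ^ℚ suc m
      ∎
    where open ≡-Reasoning

𝟙-isMinEdge? : ∀ {n m} (Xs : Vec (Subset n) m) (S : Subset n) →
  𝟙 (isMinEdge? Xs S) ≡ 𝟙ᵇ (does (all? (λ X → ¬? (X ⊂? S)) Xs))
                      - 𝟙ᵇ (does (all? (λ X → ¬? (X ⊂? S) ×-dec ¬? (X ≟S S)) Xs))
𝟙-isMinEdge? Xs S = begin
  𝟙 (isMinEdge? Xs S)
    ≡⟨ 𝟙≡𝟙ᵇ∘does (isMinEdge? Xs S) ⟩
  𝟙ᵇ (hit ∧ noProper)
    ≡⟨ 𝟙ᵇ[b∧a]≡𝟙ᵇa-𝟙ᵇ[a∧¬b] hit noProper ⟩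
  𝟙ᵇ noProper - 𝟙ᵇ (noProper ∧ not hit)
    ≡⟨ cong (λ b → 𝟙ᵇ noProper - 𝟙ᵇ b)
        (sym (does-all?-×-¬any? (λ X → ¬? (X ⊂? S)) (_≟S S) Xs)) ⟩
  𝟙ᵇ noProper - 𝟙ᵇ (does (all? (λ X → ¬? (X ⊂? S) ×-dec ¬? (X ≟S S)) Xs))
    ∎
  where
  open ≡-Reasoning
  hit noProper : Bool
  hit      = does (any? (_≟S S) Xs)
  noProper = does (all? (λ X → ¬? (X ⊂? S)) Xs)

𝔼minOfSize : ℕ → ℕ → ℚ → ℕ → ℚ
𝔼minOfSize n m p i = ℕ→ℚ (n C i) * (pr¬⊂ n p i ^ℚ m - pr¬⊆ n p i ^ℚ m)

𝔼-minCount : ∀ n m p → 𝔼 n m p minCount ≡ Σ0to n (𝔼minOfSize n m p)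
𝔼-minCount n m p = begin
  𝔼 n m p minCount
    ≡⟨ 𝔼-Σl p m (allSubsets n) (λ Xs S → 𝟙 (isMinEdge? Xs S)) ⟩
  Σl (allSubsets n) (λ S → 𝔼 n m p (λ Xs → 𝟙 (isMinEdge? Xs S)))
    ≡⟨ Σl-cong (allSubsets n) 𝔼-𝟙-isMinEdge? ⟩
  Σl (allSubsets n) (λ S → pr¬⊂ n p ∣ S ∣ ^ℚ m - pr¬⊆ n p ∣ S ∣ ^ℚ m)
    ≡⟨ Σl-allSubsets-∣∣ n (λ i → pr¬⊂ n p i ^ℚ m - pr¬⊆ n p i ^ℚ m) ⟩
  Σ0to n (𝔼minOfSize n m p)
    ∎
  where
  open ≡-Reasoning
  𝔼-𝟙-isMinEdge? : ∀ S → 𝔼 n m p (λ Xs → 𝟙 (isMinEdge? Xs S)) ≡ pr¬⊂ n p ∣ S ∣ ^ℚ m - pr¬⊆ n p ∣ S ∣ ^ℚ m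
  𝔼-𝟙-isMinEdge? S = trans (𝔼-cong p m (λ Xs → 𝟙-isMinEdge? Xs S)) (trans (𝔼-sub p m _ _) (cong₂ _-_
    (trans (𝔼-all? p (λ X → ¬? (X ⊂? S)) m) (cong (_^ℚ m) (𝔼₁-¬⊂ p S)))
    (trans (𝔼-all? p (λ X → ¬? (X ⊂? S) ×-dec ¬? (X ≟S S)) m) (cong (_^ℚ m) (𝔼₁-¬⊂∧≢ p S)))))

∣initSeg∣ : ∀ {n i} → i ℕ.≤ n → ∣ initSeg n i ∣ ≡ i
∣initSeg∣ {zero}  z≤n     = refl
∣initSeg∣ {suc n} z≤n     = ∣initSeg∣ {n} z≤n
∣initSeg∣ {suc n} (s≤s i≤n) = cong suc (∣initSeg∣ i≤n)

w≡pr¬⊂^m : ∀ {n i} p m → i ℕ.≤ n → w n p i m ≡ pr¬⊂ n p i ^ℚ m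
w≡pr¬⊂^m {n} {i} p m i≤n = begin
  w n p i m                                               ≡⟨ 𝔼-cong p m (λ Xs → 𝟙≡𝟙ᵇ∘does (all? P? Xs)) ⟩
  𝔼 n m p (λ Xs → 𝟙ᵇ (does (all? P? Xs)))                 ≡⟨ 𝔼-all? p P? m ⟩
  𝔼₁ n p (λ X → 𝟙ᵇ (not (does (X ⊂? initSeg n i)))) ^ℚ m  ≡⟨ cong (_^ℚ m) (𝔼₁-¬⊂ p (initSeg n i)) ⟩
  pr¬⊂ n p ∣ initSeg n i ∣ ^ℚ m                           ≡⟨ cong (λ k → pr¬⊂ n p k ^ℚ m) (∣initSeg∣ i≤n) ⟩
  pr¬⊂ n p i ^ℚ m                                         ∎
  where
  open ≡-Reasoning
  P? = λ X → ¬? (X ⊂? initSeg n i)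

pr¬⊂-pr¬⊆≡1-pr≢ : ∀ n p i → pr¬⊂ n p i - pr¬⊆ n p i ≡ 1ℚ - pr≢ n p i
pr¬⊂-pr¬⊆≡1-pr≢ n p i =
  solve 2 (λ x y → (con 1ℚ :- x :* (con 1ℚ :- y)) :- (con 1ℚ :- x) := con 1ℚ :- (con 1ℚ :- y :* x))
    refl ((1ℚ - p) ^ℚ (n ∸ i)) (p ^ℚ i)

module _ {p : ℚ} (0≤p : 0ℚ ≤ p) (p≤1 : p ≤ 1ℚ) (n i : ℕ) where
  private
    x y : ℚ
    x = (1ℚ - p) ^ℚ (n ∸ i)
    y = p ^ℚ i
    0≤1-p : 0ℚ ≤ 1ℚ - p
    0≤1-p = p≤q⇒0≤q-p p≤1
    1-p≤1 : 1ℚ - p ≤ 1ℚ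
    1-p≤1 = 0≤q-p⇒p≤q (subst (0ℚ ≤_) (solve 1 (λ p → p := con 1ℚ :- (con 1ℚ :- p)) refl p) 0≤p)
    0≤x : 0ℚ ≤ x
    0≤x = ^ℚ-nonNeg (n ∸ i) 0≤1-p
    x≤1 : x ≤ 1ℚ
    x≤1 = ^ℚ-≤1 (n ∸ i) 0≤1-p 1-p≤1
    0≤y : 0ℚ ≤ y
    0≤y = ^ℚ-nonNeg i 0≤p
    0≤1-y : 0ℚ ≤ 1ℚ - y
    0≤1-y = p≤q⇒0≤q-p (^ℚ-≤1 i 0≤p p≤1)
    0≤yx : 0ℚ ≤ y * x
    0≤yx = 0≤p*q 0≤y 0≤x

  0≤pr¬⊆ : 0ℚ ≤ pr¬⊆ n p i
  0≤pr¬⊆ = p≤q⇒0≤q-p x≤1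

  pr¬⊆≤pr¬⊂ : pr¬⊆ n p i ≤ pr¬⊂ n p i
  pr¬⊆≤pr¬⊂ = 0≤q-p⇒p≤q (subst (0ℚ ≤_)
    (solve 2 (λ x y → y :* x := (con 1ℚ :- x :* (con 1ℚ :- y)) :- (con 1ℚ :- x)) refl x y) 0≤yx)

  0≤pr¬⊂ : 0ℚ ≤ pr¬⊂ n p i
  0≤pr¬⊂ = ℚ.≤-trans 0≤pr¬⊆ pr¬⊆≤pr¬⊂

  pr¬⊂≤1 : pr¬⊂ n p i ≤ 1ℚ
  pr¬⊂≤1 = 0≤q-p⇒p≤q (subst (0ℚ ≤_)
    (solve 2 (λ x y → x :* (con 1ℚ :- y) := con 1ℚ :- (con 1ℚ :- x :* (con 1ℚ :- y))) refl x y)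
    (0≤p*q 0≤x 0≤1-y))

  pr¬⊆≤pr¬⊂*pr≢ : pr¬⊆ n p i ≤ pr¬⊂ n p i * pr≢ n p i
  pr¬⊆≤pr¬⊂*pr≢ = 0≤q-p⇒p≤q (subst (0ℚ ≤_)
    (solve 2 (λ x y → (x :* x) :* (y :* (con 1ℚ :- y))
                      := (con 1ℚ :- x :* (con 1ℚ :- y)) :* (con 1ℚ :- y :* x) :- (con 1ℚ :- x)) refl x y)
    (0≤p*q (0≤p*q 0≤x 0≤x) (0≤p*q 0≤y 0≤1-y)))

  0≤term : ∀ m → 0ℚ ≤ term n m p i
  0≤term m = 0≤p*q (ℕ→ℚ-nonNeg (n C i)) (p≤q⇒0≤q-p (^ℚ-≤1 m 0≤pr≢ pr≢≤1))
    where
    0≤pr≢ : 0ℚ ≤ pr≢ n p i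
    0≤pr≢ = p≤q⇒0≤q-p (*-mono-≤-nonNeg 0≤y 0≤x (^ℚ-≤1 i 0≤p p≤1) x≤1)
    pr≢≤1 : pr≢ n p i ≤ 1ℚ
    pr≢≤1 = 0≤q-p⇒p≤q (subst (0ℚ ≤_) (solve 1 (λ z → z := con 1ℚ :- (con 1ℚ :- z)) refl (y * x)) 0≤yx)

  p≤pr¬⊂ : i ℕ.< n → p ≤ pr¬⊂ n p i
  p≤pr¬⊂ i<n = ℚ.≤-trans p≤pr¬⊆ pr¬⊆≤pr¬⊂
    where
    x≤1-p : x ≤ 1ℚ - p
    x≤1-p = subst (λ k → (1ℚ - p) ^ℚ k ≤ 1ℚ - p) (sym (ℕ.+-∸-assoc 1 i<n))
      (subst ((1ℚ - p) * (1ℚ - p) ^ℚ (n ∸ suc i) ≤_) (ℚ.*-identityʳ (1ℚ - p))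
        (ℚ.*-monoˡ-≤-nonNeg (1ℚ - p) {{nonNegative 0≤1-p}} (^ℚ-≤1 (n ∸ suc i) 0≤1-p 1-p≤1)))
    p≤pr¬⊆ : p ≤ pr¬⊆ n p i
    p≤pr¬⊆ = 0≤q-p⇒p≤q (subst (0ℚ ≤_)
      (solve 2 (λ p x → (con 1ℚ :- p) :- x := (con 1ℚ :- x) :- p) refl p x) (p≤q⇒0≤q-p x≤1-p))

module _ {p : ℚ} (0≤p : 0ℚ ≤ p) (p≤1 : p ≤ 1ℚ) {n i : ℕ} (i≤n : i ℕ.≤ n) where
  private
    a c : ℚ
    a = pr¬⊂ n p i
    c = pr≢ n p i
    w≡a^ : ∀ m → w n p i m ≡ a ^ℚ m
    w≡a^ m = w≡pr¬⊂^m p m i≤n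
    0≤Cni : 0ℚ ≤ ℕ→ℚ (n C i)
    0≤Cni = ℕ→ℚ-nonNeg (n C i)

  term*w≤𝔼minOfSize : ∀ m → term n m p i * w n p i m ≤ 𝔼minOfSize n m p i
  term*w≤𝔼minOfSize m = begin
    term n m p i * w n p i m
      ≡⟨ cong (term n m p i *_) (w≡a^ m) ⟩
    term n m p i * a ^ℚ m
      ≡⟨ ℚ.*-assoc (ℕ→ℚ (n C i)) _ _ ⟩
    ℕ→ℚ (n C i) * ((1ℚ - c ^ℚ m) * a ^ℚ m)
      ≤⟨ ℚ.*-monoˡ-≤-nonNeg (ℕ→ℚ (n C i)) {{nonNegative 0≤Cni}}
          (powerGap-lower (0≤pr¬⊆ 0≤p p≤1 n i) (pr¬⊆≤pr¬⊂*pr≢ 0≤p p≤1 n i) m) ⟩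
    𝔼minOfSize n m p i
      ∎
    where open ℚ.≤-Reasoning

  𝔼minOfSize≤term*w : ∀ k → 𝔼minOfSize n (suc k) p i ≤ term n (suc k) p i * w n p i k
  𝔼minOfSize≤term*w k = begin
    𝔼minOfSize n (suc k) p i
      ≤⟨ ℚ.*-monoˡ-≤-nonNeg (ℕ→ℚ (n C i)) {{nonNegative 0≤Cni}}
            (powerGap-upper (0≤pr¬⊆ 0≤p p≤1 n i) (pr¬⊆≤pr¬⊂*pr≢ 0≤p p≤1 n i)
              (pr¬⊆≤pr¬⊂ 0≤p p≤1 n i) (pr¬⊂-pr¬⊆≡1-pr≢ n p i) k) ⟩
    ℕ→ℚ (n C i) * ((1ℚ - c ^ℚ suc k) * a ^ℚ k)
      ≡⟨ sym (ℚ.*-assoc (ℕ→ℚ (n C i)) _ _) ⟩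
    term n (suc k) p i * a ^ℚ k
      ≡⟨ cong (term n (suc k) p i *_) (sym (w≡a^ k)) ⟩
    term n (suc k) p i * w n p i k
      ∎
    where open ℚ.≤-Reasoning

  0≤term*w : ∀ m j → 0ℚ ≤ term n m p i * w n p i j
  0≤term*w m j = subst (λ v → 0ℚ ≤ term n m p i * v) (sym (w≡a^ j))
    (0≤p*q (0≤term 0≤p p≤1 n i m) (^ℚ-nonNeg j (0≤pr¬⊂ 0≤p p≤1 n i)))

𝔼minOfSize≤1/p*term*w : ∀ {p} (0<p : 0ℚ < p) → p ≤ 1ℚ → ∀ {n i} → i ℕ.< n → ∀ k →
  𝔼minOfSize n (suc k) p i ≤ (1/ p) {{>-nonZero 0<p}} * (term n (suc k) p i * w n p i (suc k))
𝔼minOfSize≤1/p*term*w {p} 0<p p≤1 {n} {i} i<n k = begin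
  𝔼minOfSize n (suc k) p i      ≤⟨ 𝔼minOfSize≤term*w 0≤p p≤1 i≤n k ⟩
  Tw                            ≡⟨ sym (1/p*[p*q]≡q Tw) ⟩
  1/ p * (p * Tw)               ≤⟨ ℚ.*-monoˡ-≤-nonNeg (1/ p) {{nonNegative (0≤1/p 0<p)}}
                                     (ℚ.*-monoʳ-≤-nonNeg Tw {{nonNegative (0≤term*w 0≤p p≤1 i≤n (suc k) k)}}
                                       (p≤pr¬⊂ 0≤p p≤1 n i i<n)) ⟩
  1/ p * (a * Tw)               ≡⟨ cong (1/ p *_) a*Tw≡ ⟩
  1/ p * (T * w n p i (suc k))  ∎
  where
  open ℚ.≤-Reasoning
  instance
    _ = >-nonZero 0<p
  0≤p = ℚ.<⇒≤ 0<p
  i≤n = ℕ.<⇒≤ i<n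
  a = pr¬⊂ n p i
  T = term n (suc k) p i
  Tw = T * w n p i k
  1/p*[p*q]≡q : ∀ q → 1/ p * (p * q) ≡ q
  1/p*[p*q]≡q q = trans (sym (ℚ.*-assoc (1/ p) p q)) (trans (cong (_* q) (ℚ.*-inverseˡ p)) (ℚ.*-identityˡ q))
  a*Tw≡ : a * Tw ≡ T * w n p i (suc k)
  a*Tw≡ = begin-equality
    a * (T * w n p i k)  ≡⟨ cong (λ v → a * (T * v)) (w≡pr¬⊂^m p k i≤n) ⟩
    a * (T * a ^ℚ k)     ≡⟨ solve 3 (λ a T A → a :* (T :* A) := T :* (a :* A)) refl a T (a ^ℚ k) ⟩
    T * a ^ℚ suc k       ≡⟨ cong (T *_) (sym (w≡pr¬⊂^m p (suc k) i≤n)) ⟩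
    T * w n p i (suc k)  ∎

𝔼minOfSize[n]≤1 : ∀ {p} → 0ℚ ≤ p → p ≤ 1ℚ → ∀ n m → 𝔼minOfSize n m p n ≤ 1ℚ
𝔼minOfSize[n]≤1 {p} 0≤p p≤1 n m = begin
  ℕ→ℚ (n C n) * D  ≡⟨ cong (λ k → ℕ→ℚ k * D) (nCn≡1 n) ⟩
  1ℚ * D           ≡⟨ ℚ.*-identityˡ D ⟩
  D                ≤⟨ powerGap-≤1 m (0≤pr¬⊂ 0≤p p≤1 n n) (pr¬⊂≤1 0≤p p≤1 n n) (0≤pr¬⊆ 0≤p p≤1 n n) ⟩
  1ℚ               ∎
  where
  open ℚ.≤-Reasoning
  D = pr¬⊂ n p n ^ℚ m - pr¬⊆ n p n ^ℚ m

lemma14 : (p : ℚ) → (0<p : 0ℚ < p) → p < 1ℚ → (n m : ℕ) → 1 ℕ.≤ n → 1 ℕ.≤ m →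
    ((i : ℕ) → i ℕ.≤ n → w n p i m ≡ (1ℚ - ((1ℚ - p) ^ℚ (n ∸ i)) * (1ℚ - p ^ℚ i)) ^ℚ m)
    × (Σ0to n (λ i → term n m p i * w n p i m) ≤ 𝔼 n m p minCount)
    × (𝔼 n m p minCount ≤ Σ0to n (λ i → term n m p i * w n p i (m ∸ 1)))
    × (𝔼 n m p minCount ≤ 1ℚ + (1/ p) {{>-nonZero 0<p}} * Σ0to n (λ i → term n m p i * w n p i m))
lemma14 p 0<p p<1 n@(suc n-1) m@(suc k) _ _ =
    (λ i → w≡pr¬⊂^m p m)
  , (begin
      Σ0to n (λ i → term n m p i * w n p i m)  ≤⟨ Σ0to-mono n (λ i i≤n → term*w≤𝔼minOfSize 0≤p p≤1 i≤n m) ⟩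
      Σ0to n (𝔼minOfSize n m p)                ≡⟨ sym (𝔼-minCount n m p) ⟩
      𝔼 n m p minCount                         ∎)
  , (begin
      𝔼 n m p minCount                         ≡⟨ 𝔼-minCount n m p ⟩
      Σ0to n (𝔼minOfSize n m p)                ≤⟨ Σ0to-mono n (λ i i≤n → 𝔼minOfSize≤term*w 0≤p p≤1 i≤n k) ⟩
      Σ0to n (λ i → term n m p i * w n p i k)  ∎)
  , (begin
      𝔼 n m p minCount
        ≡⟨ 𝔼-minCount n m p ⟩
      Σ0to n (𝔼minOfSize n m p)
        ≤⟨ Σ0to-≤-1+r*Σ0to n-1 (1/ p)
             (λ i i≤n-1 → 𝔼minOfSize≤1/p*term*w 0<p p≤1 (s≤s i≤n-1) k)
             (𝔼minOfSize[n]≤1 0≤p p≤1 n m)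
             (0≤p*q (0≤1/p 0<p) (0≤term*w 0≤p p≤1 {n} ℕ.≤-refl m m)) ⟩
      1ℚ + 1/ p * Σ0to n (λ i → term n m p i * w n p i m)
        ∎)
  where
  open ℚ.≤-Reasoning
  instance
    _ = >-nonZero 0<p
  0≤p = ℚ.<⇒≤ 0<p
  p≤1 = ℚ.<⇒≤ p<1
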